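{- Let $k\ge1$ and let $(c_1,\dots,c_k)$ and $(m_1,\dots,m_k)$ be a consistent pair of sequences, with $n=c_1+\dots+c_k$, and let $\pi$ be the output of the stack procedure described in the context, run on this input. Then: (i) the set of ascent tops of $\pi$, $\mathrm{Atop}(\pi)=\{\pi_{i+1}: 1\le i<n,\ \pi_i<\pi_{i+1}\}$, equals $\{m_2,m_3,\dots,m_k\}$; (ii) $\pi$ has exactly $k$ inverse descent runs $I_1,\dots,I_k$, indexed so that $\max(I_1)>\dots>\max(I_k)$; and (iii) $|I_j|=c_j$ for all $1\le j\le k$.
   Context: A pair of sequences of positive integers $(c_1,\dots,c_k)$ and $(m_1,\dots,m_k)$ is consistent if: $c_1\ge 2$; $c_1+\dots+c_k=n$; $n=m_1>m_2>\dots>m_k$; and $m_i>c_i+c_{i+1}+\dots+c_k$ for all $1<i\le k$. The stack procedure: let $M=\{m_2,\dots,m_k\}$; start with two empty stacks $\mathscr{A},\mathscr{B}$ and a counter $p:=n$. For $i=1,2,\dots,k$ in order: (Step 1) repeat $c_i$ times: push $p$ onto $\mathscr{A}$ and decrease $p$ by $1$; (Step 2) while $\mathscr{A}$ is nonempty and the top of $\mathscr{A}$ is not in $M$, pop the top of $\mathscr{A}$ and push it onto $\mathscr{B}$; (Step 3) if $\mathscr{A}$ is nonempty, pop the top of $\mathscr{A}$ and push it onto $\mathscr{B}$. The output $\pi$ is the word obtained by reading $\mathscr{B}$ from top to bottom ($\pi_1$ is the top); it is a permutation of $[n]$. For $\tau\in S_n$, a descent run is a maximal set of consecutive positions $\{i,\dots,j\}$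 with $\tau_i>\tau_{i+1}>\dots>\tau_j$. An inverse descent run of $\pi\in S_n$ is a set $I\subseteq[n]$ such that $\{\pi_i:i\in I\}$ is a descent run of $\pi^{ -1}$; these sets partition $[n]$. -}

module Defs where

open import Data.Bool using (Bool; true; false; if_then_else_)
open import Data.Nat using (ℕ; zero; suc; _+_; _≤_; _<_; _>_; _≡ᵇ_; _<ᵇ_; _⊔_; _≟_)
open import Data.List using (List; []; _∷_; map; upTo; length; drop)
open import Data.Nat.ListAction using (sum)
open import Data.List.Relation.Unary.All using (All)
open import Data.List.Relation.Unary.Linked using (Linked)
open import Data.List.Relation.Binary.Pointwise using (Pointwise)
open import Data.Product using (_×_; _,_; proj₁; proj₂)
open import Data.Empty using (⊥)
open import Relation.Binary.PropositionalEquality using (_≡_)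
open import Relation.Nullary using (yes; no)

suffixSums : List ℕ → List ℕ
suffixSums []       = []
suffixSums (x ∷ xs) = (x + sum xs) ∷ suffixSums xs

-- All entries are positive integers, c₁ ≥ 2, m₁ = n,
-- m strictly decreasing, and mᵢ > cᵢ+…+cₖ for 1 < i ≤ k
-- (Pointwise also forces length c = length m, so k ≥ 1).
Consistent : ℕ → List ℕ → List ℕ → Set
Consistent n []        _         = ⊥
Consistent n (c₁ ∷ cs) []        = ⊥
Consistent n (c₁ ∷ cs) (m₁ ∷ ms) =
  2 ≤ c₁ × All (0 <_) cs × All (0 <_) (m₁ ∷ ms) ×
  sum (c₁ ∷ cs) ≡ n × m₁ ≡ n × Linked _>_ (m₁ ∷ ms) ×
  Pointwise _>_ ms (suffixSums cs)

-- The stack procedure.  Stacks are lists whose head is the top.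

pushN : ℕ → List ℕ → ℕ → List ℕ × ℕ
pushN zero    A p = A , p
pushN (suc c) A p = pushN c (p ∷ A) (p Data.Nat.∸ 1)

elemᵇ : ℕ → List ℕ → Bool
elemᵇ a []       = false
elemᵇ a (x ∷ xs) = if a ≡ᵇ x then true else elemᵇ a xs

moveWhile : List ℕ → List ℕ → List ℕ → List ℕ × List ℕ
moveWhile M []      B = [] , B
moveWhile M (a ∷ A) B =
  if elemᵇ a M then (a ∷ A) , B else moveWhile M A (a ∷ B)

moveOne : List ℕ → List ℕ → List ℕ × List ℕ
moveOne []      B = [] , B
moveOne (a ∷ A) B = A , (a ∷ B)

runSteps : List ℕ → List ℕ → List ℕ → List ℕ → ℕ → List ℕ
runSteps M []       A B p = B
runSteps M (c ∷ cs) A B p =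
  let A₁ = proj₁ (pushN c A p)
      p₁ = proj₂ (pushN c A p)
      s₂ = moveWhile M A₁ B
      s₃ = moveOne (proj₁ s₂) (proj₂ s₂)
  in runSteps M cs (proj₁ s₃) (proj₂ s₃) p₁

-- Output π (as the word π₁ π₂ … πₙ; π₁ is the top of B).
-- M = {m₂,…,mₖ} = drop 1 m.
stackProc : ℕ → List ℕ → List ℕ → List ℕ
stackProc n c m = runSteps (drop 1 m) c [] [] n

atops : List ℕ → List ℕ
atops []           = []
atops (x ∷ [])     = []
atops (x ∷ y ∷ ys) = if x <ᵇ y then y ∷ atops (y ∷ ys) else atops (y ∷ ys)

-- 1-based position of (the first occurrence of) v in a word
posOf : ℕ → List ℕ → ℕ
posOf v []       = 0
posOf v (x ∷ xs) = if v ≡ᵇ x then 1 else suc (posOf v xs)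

-- the inverse of a permutation π of [n], as the word π⁻¹(1) … π⁻¹(n)
inverse : ℕ → List ℕ → List ℕ
inverse n π = map (λ v → posOf (suc v) π) (upTo n)

private
  attach : Bool → ℕ → List (List ℕ) → List (List ℕ)
  attach true  x (b ∷ bs) = (x ∷ b) ∷ bs
  attach _     x bs       = (x ∷ []) ∷ bs

descentRuns : List ℕ → List (List ℕ)
descentRuns []           = []
descentRuns (x ∷ [])     = (x ∷ []) ∷ []
descentRuns (x ∷ y ∷ ys) = attach (y <ᵇ x) x (descentRuns (y ∷ ys))

-- Inverse descent runs of π: the sets {π⁻¹(v) : v in a descent run of π⁻¹},
-- i.e. the entries of the descent-run blocks of the word π⁻¹.
inverseDescentRuns : ℕ → List ℕ → List (List ℕ)
inverseDescentRuns n π = descentRuns (inverse n π)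

maxL : List ℕ → ℕ
maxL []       = 0
maxL (x ∷ xs) = x ⊔ maxL xs

-- Round i pushes the values s_{i+1} < v ≤ s_i, where s_i = c_i + … + c_k,
-- onto A in decreasing order, so A always increases from the top, and B read
-- from the top is π.  Inside such a block, v lies above v + 1 on A and reaches
-- B first, so v + 1 precedes v in π; every value of a later block is pushed
-- after the top of the current block has been moved, so it precedes that top
-- in π.  Hence the inverse descent runs of π are the position sets of the
-- blocks.  Call m_2, …, m_k the marks.  An entry x lands on B directly above y
-- with x < y exactly when y is a mark: step 2 moves unmarked values in
-- increasing order, step 3 moves a mark, and the next round starts with
-- smaller values.  Since m_{i+1} > s_{i+1}, the marks m_2, …, m_{i+1} have all
-- been pushed after step 1 of round i, while B holds only i − 1 marks; so step
-- 3 moves a mark in every round but the last, whose step 2 empties A.  Thus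
-- the ascent tops of π are exactly the marks.
module Submission where

open import Defs
open import Data.Nat using (ℕ; _>_)
open import Data.List using (List; map; length; drop)
open import Data.List.Membership.Propositional using (_∈_)
open import Data.List.Relation.Unary.Linked using (Linked)
open import Data.List.Relation.Binary.Permutation.Propositional using (_↭_)
open import Data.Product using (_×_; ∃)
open import Function.Bundles using (_⇔_)
open import Relation.Binary.PropositionalEquality using (_≡_)

open import Data.Bool using (true; false)
open import Data.Empty using (⊥-elim)
open import Data.Nat using (zero; suc; _+_; _≤_; _<_; _≡ᵇ_; _<ᵇ_; _⊔_; _≟_; _≤?_; z≤n; s≤s; z<s)
open import Data.Nat.ListAction using (sum)
open import Data.Nat.Properties
open import Data.List using ([]; _∷_; _++_; head; last; reverse; filter; applyUpTo; upTo)
open import Data.List.Properties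
  using ( ++-assoc; ++-identityʳ; length-++; length-map; map-++; map-∘; map-upTo; unfold-reverse
        ; filter-++; filter-accept; filter-reject; filter-all; filter-none; filter-notAll)
open import Data.List.Membership.Propositional using (_∉_; find)
open import Data.List.Membership.Propositional.Properties using (∈-++⁻; ∈-++⁺ˡ; ∈-++⁺ʳ)
open import Data.List.Membership.DecPropositional _≟_ using (_∈?_)
open import Data.List.Relation.Unary.Any using (here; there)
import Data.List.Relation.Unary.Any as Any
open import Data.List.Relation.Unary.All using (All; []; _∷_)
import Data.List.Relation.Unary.All as All
open import Data.List.Relation.Unary.All.Properties using (¬All⇒Any¬; All¬⇒¬Any) renaming (++⁺ to All-++⁺)
open import Data.List.Relation.Unary.AllPairs using (_∷_)
import Data.List.Relation.Unary.AllPairs as AllPairs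
open import Data.List.Relation.Unary.Unique.Propositional using (Unique)
open import Data.List.Relation.Unary.Linked using ([]; [-]; _∷_; _∷′_)
import Data.List.Relation.Unary.Linked as Linked
open import Data.List.Relation.Unary.Linked.Properties using (Linked⇒AllPairs)
open import Data.List.Relation.Binary.Pointwise using (Pointwise; []; _∷_)
open import Data.List.Relation.Binary.Permutation.Propositional using (↭-sym)
open import Data.List.Relation.Binary.Permutation.Propositional.Properties using (↭-reverse)
open import Data.Maybe using (just; nothing)
open import Data.Maybe.Relation.Binary.Connected using (Connected; just; just-nothing; nothing-just)
import Data.Maybe.Relation.Unary.All as Maybe
open Maybe using (just; nothing)
open import Data.Product using (_,_; proj₁; proj₂; uncurry)
open import Data.Sum using (_⊎_; inj₁; inj₂; fromInj₁; fromInj₂)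
open import Function using (_∘_)
open import Function.Bundles using (mk⇔; Equivalence)
open import Relation.Binary.Definitions using (Transitive)
open import Relation.Binary.PropositionalEquality
  using (refl; sym; trans; cong; cong₂; subst; subst₂; _≢_; module ≡-Reasoning)
open import Relation.Nullary using (Dec; yes; no)
open import Relation.Nullary.Reflects using (Reflects; ofʸ; ofⁿ; fromEquivalence)

≡ᵇ-reflects-≡ : ∀ m n → Reflects (m ≡ n) (m ≡ᵇ n)
≡ᵇ-reflects-≡ m n = fromEquivalence (≡ᵇ⇒≡ m n) (≡⇒≡ᵇ m n)

∉-∷ : ∀ {x a : ℕ} {B} → x ≢ a → x ∉ B → x ∉ a ∷ B
∉-∷ x≢a x∉B (here x≡a)  = x≢a x≡a
∉-∷ x≢a x∉B (there x∈B) = x∉B x∈B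

elemᵇ-reflects-∈ : ∀ a xs → Reflects (a ∈ xs) (elemᵇ a xs)
elemᵇ-reflects-∈ a []       = ofⁿ λ ()
elemᵇ-reflects-∈ a (x ∷ xs) with a ≡ᵇ x | ≡ᵇ-reflects-≡ a x
... | true  | ofʸ refl = ofʸ (here refl)
... | false | ofⁿ a≢x with elemᵇ a xs | elemᵇ-reflects-∈ a xs
...   | true  | ofʸ a∈xs = ofʸ (there a∈xs)
...   | false | ofⁿ a∉xs = ofⁿ (∉-∷ a≢x a∉xs)

linked⇒head : ∀ {R : ℕ → ℕ → Set} → Transitive R → ∀ {x y xs} → Linked R (x ∷ xs) → y ∈ xs → R x y
linked⇒head trans linked y∈xs with Linked⇒AllPairs trans linked
... | x~xs ∷ _ = All.lookup x~xs y∈xs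

>-trans : Transitive _>_
>-trans x>y y>z = <-trans y>z x>y

decreasing⇒unique : ∀ {xs} → Linked _>_ xs → Unique xs
decreasing⇒unique xs↓ = AllPairs.map >⇒≢ (Linked⇒AllPairs >-trans xs↓)

maxL-decreasing : ∀ x xs → Linked _>_ (x ∷ xs) → maxL (x ∷ xs) ≡ x
maxL-decreasing x []       _          = ⊔-identityʳ x
maxL-decreasing x (y ∷ ys) (y<x ∷ l) = trans (cong (x ⊔_) (maxL-decreasing y ys l)) (m≥n⇒m⊔n≡m (<⇒≤ y<x))

∈-suffixSums⇒≤sum : ∀ {q} xs → q ∈ suffixSums xs → q ≤ sum xs
∈-suffixSums⇒≤sum (x ∷ xs) (here refl) = ≤-refl
∈-suffixSums⇒≤sum (x ∷ xs) (there q∈)  = ≤-trans (∈-suffixSums⇒≤sum xs q∈) (m≤n+m (sum xs) x)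

data Precedes (a b : ℕ) : List ℕ → Set where
  here  : ∀ {xs} → a ≢ b → b ∈ xs → Precedes a b (a ∷ xs)
  there : ∀ {x xs} → a ≢ x → b ≢ x → Precedes a b xs → Precedes a b (x ∷ xs)

posOf-head : ∀ a xs → posOf a (a ∷ xs) ≡ 1
posOf-head a xs with a ≡ᵇ a | ≡ᵇ-reflects-≡ a a
... | true  | _        = refl
... | false | ofⁿ a≢a = ⊥-elim (a≢a refl)

posOf-tail : ∀ {a x} xs → a ≢ x → posOf a (x ∷ xs) ≡ suc (posOf a xs)
posOf-tail {a} {x} xs a≢x with a ≡ᵇ x | ≡ᵇ-reflects-≡ a x
... | true  | ofʸ a≡x = ⊥-elim (a≢x a≡x)
... | false | _        = refl

posOf-∈ : ∀ {a xs} → a ∈ xs → 0 < posOf a xs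
posOf-∈ {a} {x ∷ xs} _ with a ≡ᵇ x
... | true  = s≤s z≤n
... | false = s≤s z≤n

Precedes⇒posOf< : ∀ {a b xs} → Precedes a b xs → posOf a xs < posOf b xs
Precedes⇒posOf< {a} {b} (here {xs} a≢b b∈xs)
  rewrite posOf-head a xs | posOf-tail xs (a≢b ∘ sym) = s≤s (posOf-∈ b∈xs)
Precedes⇒posOf< (there {xs = xs} a≢x b≢x a◃b)
  rewrite posOf-tail xs a≢x | posOf-tail xs b≢x = s≤s (Precedes⇒posOf< a◃b)

-- Ascent tops

MarkedStep : List ℕ → ℕ → ℕ → Set
MarkedStep M y x = (y < x × x ∈ M) ⊎ (x < y × x ∉ M)

atops⊆marked : ∀ {M x} w → Linked (MarkedStep M) w → x ∈ atops w → x ∈ M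
atops⊆marked (y ∷ z ∷ w) (s ∷ l) x∈ with y <ᵇ z | <ᵇ-reflects-< y z
... | false | _ = atops⊆marked (z ∷ w) l x∈
... | true  | ofʸ y<z with x∈ | s
...   | there x∈′ | _              = atops⊆marked (z ∷ w) l x∈′
...   | here refl | inj₁ (_ , z∈M) = z∈M
...   | here refl | inj₂ (z<y , _) = ⊥-elim (<-asym y<z z<y)

marked-tail⊆atops : ∀ {M x} y w → Linked (MarkedStep M) (y ∷ w) → x ∈ M → x ∈ w → x ∈ atops (y ∷ w)
marked-tail⊆atops y (z ∷ w) (s ∷ l) x∈M x∈ with y <ᵇ z | <ᵇ-reflects-< y z | x∈ | s
... | true  | _       | here refl | _              = here refl
... | true  | _       | there x∈w | _              = there (marked-tail⊆atops z w l x∈M x∈w)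
... | false | _       | there x∈w | _              = marked-tail⊆atops z w l x∈M x∈w
... | false | ofⁿ y≮z | here refl | inj₁ (y<z , _) = ⊥-elim (y≮z y<z)
... | false | _       | here refl | inj₂ (_ , z∉M) = ⊥-elim (z∉M x∈M)

marked⊆atops : ∀ {M x} w → Linked (MarkedStep M) w → Maybe.All (_∉ M) (head w) → x ∈ M → x ∈ w → x ∈ atops w
marked⊆atops (y ∷ w) _ (just y∉M) x∈M (here refl) = ⊥-elim (y∉M x∈M)
marked⊆atops (y ∷ w) l _          x∈M (there x∈w) = marked-tail⊆atops y w l x∈M x∈w

-- Descent runs

descentRuns-nonempty : ∀ x xs → ∃ λ R → ∃ λ Rs → descentRuns (x ∷ xs) ≡ R ∷ Rs
descentRuns-nonempty x []       = _ , _ , refl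
descentRuns-nonempty x (y ∷ ys) with descentRuns-nonempty y ys
... | _ , _ , eq rewrite eq with y <ᵇ x
...   | true  = _ , _ , refl
...   | false = _ , _ , refl

descentRuns-decreasing : ∀ x xs → Linked _>_ (x ∷ xs) → descentRuns (x ∷ xs) ≡ (x ∷ xs) ∷ []
descentRuns-decreasing x []       _          = refl
descentRuns-decreasing x (y ∷ ys) (y<x ∷ l)
  rewrite descentRuns-decreasing y ys l with y <ᵇ x | <ᵇ-reflects-< y x
... | true  | _        = refl
... | false | ofⁿ y≮x = ⊥-elim (y≮x y<x)

-- The private attach of Defs only reduces once the first run is exposed,
-- hence the appeal to descentRuns-nonempty.
descentRuns-++ : ∀ xs x X → Linked _>_ (x ∷ X) → Connected _≤_ (last xs) (just x) →
                 descentRuns (xs ++ x ∷ X) ≡ descentRuns xs ++ (x ∷ X) ∷ []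
descentRuns-++ []           x X dec _ = descentRuns-decreasing x X dec
descentRuns-++ (y ∷ [])     x X dec (just y≤x)
  rewrite descentRuns-decreasing x X dec with x <ᵇ y | <ᵇ-reflects-< x y
... | false | _        = refl
... | true  | ofʸ x<y = ⊥-elim (<⇒≱ x<y y≤x)
descentRuns-++ (y ∷ z ∷ zs) x X dec conn
  rewrite descentRuns-++ (z ∷ zs) x X dec conn with descentRuns-nonempty z zs
... | _ , _ , eq rewrite eq with z <ᵇ y
...   | true  = refl
...   | false = refl

count∈ : List ℕ → List ℕ → ℕ
count∈ B xs = length (filter (_∈? B) xs)

count∈-∷ : ∀ {a B} x xs k → x ≢ a → count∈ (a ∷ B) xs ≡ k + count∈ B xs →
           count∈ (a ∷ B) (x ∷ xs) ≡ k + count∈ B (x ∷ xs)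
count∈-∷ {a} {B} x xs k x≢a eq = by-cases (x ∈? B)
  where
  open ≡-Reasoning
  by-cases : Dec (x ∈ B) → count∈ (a ∷ B) (x ∷ xs) ≡ k + count∈ B (x ∷ xs)
  by-cases (yes x∈B) = begin
    count∈ (a ∷ B) (x ∷ xs) ≡⟨ cong length (filter-accept (_∈? a ∷ B) (there x∈B)) ⟩
    suc (count∈ (a ∷ B) xs) ≡⟨ cong suc eq ⟩
    suc (k + count∈ B xs)   ≡⟨ +-suc k _ ⟨
    k + suc (count∈ B xs)   ≡⟨ cong ((k +_) ∘ length) (filter-accept (_∈? B) x∈B) ⟨
    k + count∈ B (x ∷ xs)   ∎
  by-cases (no x∉B) = begin
    count∈ (a ∷ B) (x ∷ xs) ≡⟨ cong length (filter-reject (_∈? a ∷ B) (∉-∷ x≢a x∉B)) ⟩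
    count∈ (a ∷ B) xs       ≡⟨ eq ⟩
    k + count∈ B xs         ≡⟨ cong ((k +_) ∘ length) (filter-reject (_∈? B) x∉B) ⟨
    k + count∈ B (x ∷ xs)   ∎

count∈-∷-∉ : ∀ {a B} xs → a ∉ xs → count∈ (a ∷ B) xs ≡ count∈ B xs
count∈-∷-∉ []       _    = refl
count∈-∷-∉ (x ∷ xs) a∉xs = count∈-∷ x xs 0 (λ { refl → a∉xs (here refl) }) (count∈-∷-∉ xs (a∉xs ∘ there))

count∈-∷-∈ : ∀ {a B} xs → Unique xs → a ∈ xs → a ∉ B → count∈ (a ∷ B) xs ≡ suc (count∈ B xs)
count∈-∷-∈ {a} {B} (a ∷ xs) (a≢xs ∷ _) (here refl) a∉B = begin
  count∈ (a ∷ B) (a ∷ xs) ≡⟨ cong length (filter-accept (_∈? a ∷ B) (here refl)) ⟩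
  suc (count∈ (a ∷ B) xs) ≡⟨ cong suc (count∈-∷-∉ xs (All¬⇒¬Any a≢xs)) ⟩
  suc (count∈ B xs)       ≡⟨ cong (suc ∘ length) (filter-reject (_∈? B) a∉B) ⟨
  suc (count∈ B (a ∷ xs)) ∎
  where open ≡-Reasoning
count∈-∷-∈ (x ∷ xs) (x≢xs ∷ xs!) (there a∈xs) a∉B =
  count∈-∷ x xs 1 (All.lookup x≢xs a∈xs) (count∈-∷-∈ xs xs! a∈xs a∉B)

count∈-++ : ∀ B xs ys → count∈ B (xs ++ ys) ≡ count∈ B xs + count∈ B ys
count∈-++ B xs ys = trans (cong length (filter-++ (_∈? B) xs ys)) (length-++ (filter (_∈? B) xs))

count∈<length⇒∉ : ∀ {B} xs → count∈ B xs < length xs → ∃ λ y → y ∈ xs × y ∉ B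
count∈<length⇒∉ {B} xs lt =
  find (¬All⇒Any¬ (_∈? B) xs λ all∈B → <-irrefl (cong length (filter-all (_∈? B) all∈B)) lt)

count∈≡length⇒∈ : ∀ {B y} xs → count∈ B xs ≡ length xs → y ∈ xs → y ∈ B
count∈≡length⇒∈ {B} {y} xs eq y∈xs with y ∈? B
... | yes y∈B = y∈B
... | no  y∉B = ⊥-elim (<-irrefl eq (filter-notAll (_∈? B) xs (Any.map (λ { refl → y∉B }) y∈xs)))

range : ℕ → ℕ → List ℕ
range a zero    = []
range a (suc l) = a ∷ range (suc a) l

∈-range⁻ : ∀ {v} a l → v ∈ range a l → a ≤ v × v < a + l
∈-range⁻     a (suc l) (here refl) = ≤-refl , m<m+n a z<s
∈-range⁻ {v} a (suc l) (there v∈) with ∈-range⁻ (suc a) l v∈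
... | a<v , v<1+a+l = <⇒≤ a<v , subst (v <_) (sym (+-suc a l)) v<1+a+l

∈-range⁺ : ∀ {v} a l → a ≤ v → v < a + l → v ∈ range a l
∈-range⁺ {v} a zero    a≤v v<a+0 = ⊥-elim (<⇒≱ v<a+0 (subst (_≤ v) (sym (+-identityʳ a)) a≤v))
∈-range⁺ {v} a (suc l) a≤v v<a+l with m≤n⇒m<n∨m≡n a≤v
... | inj₂ refl = here refl
... | inj₁ a<v  = there (∈-range⁺ (suc a) l a<v (subst (v <_) (+-suc a l) v<a+l))

length-range : ∀ a l → length (range a l) ≡ l
length-range a zero    = refl
length-range a (suc l) = cong suc (length-range (suc a) l)

range-++ : ∀ a l m → range a (l + m) ≡ range a l ++ range (a + l) m
range-++ a zero    m rewrite +-identityʳ a = refl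
range-++ a (suc l) m rewrite +-suc a l     = cong (a ∷_) (range-++ (suc a) l m)

range-∷ʳ : ∀ a l → range a (suc l) ≡ range a l ++ (a + l) ∷ []
range-∷ʳ a l = trans (cong (range a) (+-comm 1 l)) (range-++ a l 1)

applyUpTo-range : ∀ g a l → (∀ i → g i ≡ a + i) → applyUpTo g l ≡ range a l
applyUpTo-range g a zero    g≗ = refl
applyUpTo-range g a (suc l) g≗ =
  cong₂ _∷_ (trans (g≗ 0) (+-identityʳ a))
            (applyUpTo-range (g ∘ suc) (suc a) l (λ i → trans (g≗ (suc i)) (+-suc a i)))

last-map-range : ∀ (g : ℕ → ℕ) a l → last (map g (range a (suc l))) ≡ just (g (a + l))
last-map-range g a zero    rewrite +-identityʳ a = refl
last-map-range g a (suc l) rewrite +-suc a l     = last-map-range g (suc a) l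

∷-increasing : ∀ {x xs} → (∀ {y} → y ∈ xs → x < y) → Linked _<_ xs → Linked _<_ (x ∷ xs)
∷-increasing {xs = []}    _  _ = [-]
∷-increasing {xs = y ∷ _} x< l = x< (here refl) ∷ l

range-++-increasing : ∀ a l {A} → Linked _<_ A → (∀ {y} → y ∈ A → a + l ≤ y) → Linked _<_ (range a l ++ A)
range-++-increasing a zero        A↑ above = A↑
range-++-increasing a (suc l) {A} A↑ above =
  ∷-increasing a<rest (range-++-increasing (suc a) l A↑ (λ {y} y∈A → subst (_≤ y) (+-suc a l) (above y∈A)))
  where
  a<rest : ∀ {y} → y ∈ range (suc a) l ++ A → a < y
  a<rest y∈ with ∈-++⁻ (range (suc a) l) y∈
  ... | inj₁ y∈range = proj₁ (∈-range⁻ (suc a) l y∈range)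
  ... | inj₂ y∈A     = <-≤-trans (m<m+n a z<s) (above y∈A)

map-range-linked : ∀ {R : ℕ → ℕ → Set} (g : ℕ → ℕ) a l →
                   (∀ {v} → a ≤ v → suc v < a + l → R (g v) (g (suc v))) → Linked R (map g (range a l))
map-range-linked g a zero          step = []
map-range-linked g a (suc zero)    step = [-]
map-range-linked g a (suc (suc l)) step =
  step ≤-refl (subst (suc a <_) (sym (+-suc a (suc l))) (s≤s (m<m+n a z<s))) ∷
  map-range-linked g (suc a) (suc l)
    (λ {v} a<v v<a+l → step (<⇒≤ a<v) (subst (suc v <_) (sym (+-suc a (suc l))) v<a+l))

pushN-range : ∀ c A q → pushN c A (c + q) ≡ (range (suc q) c ++ A , q)
pushN-range zero    A q = refl
pushN-range (suc c) A q = begin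
  pushN c (suc (c + q) ∷ A) (c + q)        ≡⟨ pushN-range c _ q ⟩
  (range (suc q) c ++ suc (c + q) ∷ A , q) ≡⟨ cong (λ z → (range (suc q) c ++ suc z ∷ A , q)) (+-comm c q) ⟩
  (range (suc q) c ++ suc (q + c) ∷ A , q) ≡⟨ cong (_, q) (++-assoc (range (suc q) c) _ A) ⟨
  ((range (suc q) c ++ _) ++ A , q)        ≡⟨ cong (λ z → (z ++ A , q)) (range-∷ʳ (suc q) c) ⟨
  (range (suc q) (suc c) ++ A , q)         ∎
  where open ≡-Reasoning

inverse≡map-posOf : ∀ n π → inverse n π ≡ map (λ v → posOf v π) (range 1 n)
inverse≡map-posOf n π = begin
  map ((λ v → posOf v π) ∘ suc) (upTo n)   ≡⟨ map-∘ (upTo n) ⟩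
  map (λ v → posOf v π) (map suc (upTo n)) ≡⟨ cong (map _) (map-upTo suc n) ⟩
  map (λ v → posOf v π) (applyUpTo suc n)  ≡⟨ cong (map _) (applyUpTo-range suc 1 n (λ _ → refl)) ⟩
  map (λ v → posOf v π) (range 1 n)        ∎
  where open ≡-Reasoning

-- Words made of decreasing blocks

-- blocks c lists the images under f of the value blocks (s_2, s_1], (s_3, s_2], …,
-- where s_i = c_i + … + c_k; the boundaries s_2, …, s_k are suffixSums (drop 1 c).
module Blocks (f : ℕ → ℕ) where

  blocks : List ℕ → List (List ℕ)
  blocks []       = []
  blocks (c ∷ cs) = map f (range (suc (sum cs)) c) ∷ blocks cs

  length-blocks : ∀ c → map length (blocks c) ≡ c
  length-blocks []       = refl
  length-blocks (c ∷ cs) = cong₂ _∷_ (trans (length-map f (range _ c)) (length-range _ c)) (length-blocks cs)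

  DecreasingWithin : List ℕ → Set
  DecreasingWithin c = ∀ {v} → 0 < v → suc v ≤ sum c → v ∉ suffixSums (drop 1 c) → f (suc v) < f v

  IncreasingAcross : List ℕ → Set
  IncreasingAcross c = ∀ {q v} → q ∈ suffixSums (drop 1 c) → 0 < v → v ≤ q → f v < f (suc q)

  DecreasingWithin-tail : ∀ c cs → DecreasingWithin (c ∷ cs) → DecreasingWithin cs
  DecreasingWithin-tail c []       dec _   ()
  DecreasingWithin-tail c (x ∷ xs) dec 0<v sv≤ v∉ =
    dec 0<v (≤-trans sv≤ (m≤n+m _ c)) (∉-∷ (λ { refl → <-irrefl refl sv≤ }) v∉)

  IncreasingAcross-tail : ∀ c cs → IncreasingAcross (c ∷ cs) → IncreasingAcross cs
  IncreasingAcross-tail c []       inc ()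
  IncreasingAcross-tail c (x ∷ xs) inc q∈ = inc (there q∈)

  first-block-decreasing : ∀ c cs → DecreasingWithin (c ∷ cs) → Linked _>_ (map f (range (suc (sum cs)) c))
  first-block-decreasing c cs dec = map-range-linked f (suc (sum cs)) c λ {v} s<v sv< →
    dec (≤-<-trans z≤n s<v) (subst (suc v ≤_) (+-comm (sum cs) c) (≤-pred sv<))
        (λ v∈ → <⇒≱ s<v (∈-suffixSums⇒≤sum cs v∈))

  last-before-first-block : ∀ c cs → All (0 <_) cs → IncreasingAcross (c ∷ cs) →
    Connected _≤_ (last (map f (range 1 (sum cs)))) (just (f (suc (sum cs))))
  last-before-first-block c []           _        inc = nothing-just
  last-before-first-block c (zero ∷ xs)  (() ∷ _) inc
  last-before-first-block c (suc x ∷ xs) _        inc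
    rewrite last-map-range f 1 (x + sum xs) = just (<⇒≤ (inc (here refl) (s≤s z≤n) ≤-refl))

  descentRuns-blocks : ∀ c → All (0 <_) c → DecreasingWithin c → IncreasingAcross c →
                       descentRuns (map f (range 1 (sum c))) ≡ reverse (blocks c)
  descentRuns-blocks []           _          _   _   = refl
  descentRuns-blocks (suc c ∷ cs) (_ ∷ cs>0) dec inc = begin
    descentRuns (map f (range 1 (suc c + s)))
      ≡⟨ cong (descentRuns ∘ map f) (trans (cong (range 1) (+-comm (suc c) s)) (range-++ 1 s (suc c))) ⟩
    descentRuns (map f (range 1 s ++ block))
      ≡⟨ cong descentRuns (map-++ f (range 1 s) block) ⟩
    descentRuns (map f (range 1 s) ++ map f block)
      ≡⟨ descentRuns-++ (map f (range 1 s)) _ _ (first-block-decreasing (suc c) cs dec)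
                                                (last-before-first-block (suc c) cs cs>0 inc) ⟩
    descentRuns (map f (range 1 s)) ++ map f block ∷ []
      ≡⟨ cong (_++ map f block ∷ []) (descentRuns-blocks cs cs>0 (DecreasingWithin-tail (suc c) cs dec)
                                                                 (IncreasingAcross-tail (suc c) cs inc)) ⟩
    reverse (blocks cs) ++ map f block ∷ []
      ≡⟨ unfold-reverse (map f block) (blocks cs) ⟨
    reverse (blocks (suc c ∷ cs)) ∎
    where
    open ≡-Reasoning
    s : ℕ
    s = sum cs
    block : List ℕ
    block = range (suc s) (suc c)

  maxima-blocks : ∀ c → All (0 <_) c → DecreasingWithin c → IncreasingAcross c →
                  Linked _>_ (map maxL (blocks c))
  maxima-blocks []                    _                 _   _   = []
  maxima-blocks (c ∷ [])              _                 _   _   = [-]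
  maxima-blocks (suc c ∷ suc c′ ∷ cs) (_ ∷ c′>0 ∷ cs>0) dec inc =
    subst₂ _>_ (sym (maxL-decreasing _ _ (first-block-decreasing (suc c) (suc c′ ∷ cs) dec)))
               (sym (maxL-decreasing _ _ (first-block-decreasing (suc c′) cs dec′)))
               (inc (here refl) (s≤s z≤n) (s≤s (m≤n+m (sum cs) c′))) ∷
    maxima-blocks (suc c′ ∷ cs) (c′>0 ∷ cs>0) dec′ (IncreasingAcross-tail (suc c) _ inc)
    where
    dec′ : DecreasingWithin (suc c′ ∷ cs)
    dec′ = DecreasingWithin-tail (suc c) (suc c′ ∷ cs) dec

-- The stack procedure

-- Stacks are lists with the top at the head, so the word π is B itself and
-- Precedes a b B says that a comes before b in π.  Pushed p v: v has already
-- been pushed when the counter reads p.  The values v and v + 1 lie in the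
-- same block unless v is one of the boundaries.
module Simulation (M : List ℕ) (n : ℕ) (boundaries : List ℕ)
                  (M-unique : Unique M) (M≤n : ∀ {y} → y ∈ M → y ≤ n) where

  Step : ℕ → ℕ → Set
  Step = MarkedStep M

  Pushed : ℕ → ℕ → Set
  Pushed p v = p < v × v ≤ n

  record Invariant (p : ℕ) (A B : List ℕ) : Set where
    field
      A-increasing : Linked _<_ A
      A-pushed     : ∀ {x} → x ∈ A → Pushed p x
      B-pushed     : ∀ {x} → x ∈ B → Pushed p x
      disjoint     : ∀ {x} → x ∈ A → x ∉ B
      complete     : ∀ {v} → Pushed p v → v ∈ A ⊎ v ∈ B
      B-steps      : Linked Step B
      within       : ∀ {v} → suc v ∈ B → v ∈ B → v ∉ boundaries → Precedes (suc v) v B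
      straddling   : ∀ {v} → v ∈ A → suc v ∈ B → v ∈ boundaries
      moved        : ∀ {q} → q ∈ boundaries → p < q → suc q ∈ B
      across       : ∀ {q v} → q ∈ boundaries → p < q → v ≤ q → v ∈ B → Precedes v (suc q) B

  Ready : List ℕ → List ℕ → Set
  Ready A B = Connected Step (head A) (head B)

  pop : ∀ {p x A B} → Invariant p (x ∷ A) B → Ready (x ∷ A) B → Invariant p A (x ∷ B)
  pop {p} {x} {A} {B} I ready = record
    { A-increasing = Linked.tail A-increasing
    ; A-pushed     = A-pushed ∘ there
    ; B-pushed     = λ { (here refl) → A-pushed (here refl) ; (there y∈B) → B-pushed y∈B }
    ; disjoint     = disjoint′
    ; complete     = complete′
    ; B-steps      = ready ∷′ B-steps
    ; within       = within′
    ; straddling   = straddling′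
    ; moved        = λ q∈ p<q → there (moved q∈ p<q)
    ; across       = across′
    }
    where
    open Invariant I
    x<A : ∀ {y} → y ∈ A → x < y
    x<A = linked⇒head <-trans A-increasing
    ≢x : ∀ {y} → y ∈ B → y ≢ x
    ≢x y∈B refl = disjoint (here refl) y∈B
    disjoint′ : ∀ {y} → y ∈ A → y ∉ x ∷ B
    disjoint′ y∈A (here refl) = <-irrefl refl (x<A y∈A)
    disjoint′ y∈A (there y∈B) = disjoint (there y∈A) y∈B
    complete′ : ∀ {v} → Pushed p v → v ∈ A ⊎ v ∈ x ∷ B
    complete′ pushed with complete pushed
    ... | inj₁ (here refl) = inj₂ (here refl)
    ... | inj₁ (there v∈A) = inj₁ v∈A
    ... | inj₂ v∈B         = inj₂ (there v∈B)
    within′ : ∀ {v} → suc v ∈ x ∷ B → v ∈ x ∷ B → v ∉ boundaries → Precedes (suc v) v (x ∷ B)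
    within′ (here refl)  (here v≡x)  _  = ⊥-elim (1+n≢n (sym v≡x))
    within′ (here refl)  (there v∈B) _  = here 1+n≢n v∈B
    within′ (there sv∈B) (here refl)  v∉ = ⊥-elim (v∉ (straddling (here refl) sv∈B))
    within′ (there sv∈B) (there v∈B) v∉ = there (≢x sv∈B) (≢x v∈B) (within sv∈B v∈B v∉)
    straddling′ : ∀ {v} → v ∈ A → suc v ∈ x ∷ B → v ∈ boundaries
    straddling′ v∈A (here refl)  = ⊥-elim (<-asym (x<A v∈A) (n<1+n _))
    straddling′ v∈A (there sv∈B) = straddling (there v∈A) sv∈B
    across′ : ∀ {q v} → q ∈ boundaries → p < q → v ≤ q → v ∈ x ∷ B → Precedes v (suc q) (x ∷ B)
    across′ q∈ p<q v≤q (here refl) = here (<⇒≢ (s≤s v≤q)) (moved q∈ p<q)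
    across′ q∈ p<q v≤q (there v∈B) = there (≢x v∈B) (≢x (moved q∈ p<q)) (across q∈ p<q v≤q v∈B)

  push : ∀ {p c A B} → Invariant (c + p) A B → c + p ≤ n →
         (c + p ∈ boundaries ⇔ suc (c + p) ∈ B) →
         (∀ {q} → q ∈ boundaries → p < q → c + p ≤ q) →
         Invariant p (range (suc p) c ++ A) B
  push {p} {c} {A} {B} I c+p≤n boundary⇔moved gap = record
    { A-increasing = range-++-increasing (suc p) c A-increasing
                       (λ {y} y∈A → subst (_≤ y) (cong suc (+-comm c p)) (proj₁ (A-pushed y∈A)))
    ; A-pushed     = A′-pushed
    ; B-pushed     = older ∘ B-pushed
    ; disjoint     = disjoint′
    ; complete     = complete′
    ; B-steps      = B-steps
    ; within       = within
    ; straddling   = straddling′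
    ; moved        = moved′
    ; across       = across′
    }
    where
    open Invariant I
    older : ∀ {v} → Pushed (c + p) v → Pushed p v
    older (c+p<v , v≤n) = ≤-<-trans (m≤n+m p c) c+p<v , v≤n
    new : ∀ {v} → v ∈ range (suc p) c → p < v × v ≤ c + p
    new {v} v∈ with ∈-range⁻ (suc p) c v∈
    ... | p<v , v<1+p+c = p<v , subst (v ≤_) (+-comm p c) (≤-pred v<1+p+c)
    A′-pushed : ∀ {v} → v ∈ range (suc p) c ++ A → Pushed p v
    A′-pushed v∈ with ∈-++⁻ (range (suc p) c) v∈
    ... | inj₁ v∈new = proj₁ (new v∈new) , ≤-trans (proj₂ (new v∈new)) c+p≤n
    ... | inj₂ v∈A   = older (A-pushed v∈A)
    disjoint′ : ∀ {v} → v ∈ range (suc p) c ++ A → v ∉ B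
    disjoint′ v∈ v∈B with ∈-++⁻ (range (suc p) c) v∈
    ... | inj₁ v∈new = <⇒≱ (proj₁ (B-pushed v∈B)) (proj₂ (new v∈new))
    ... | inj₂ v∈A   = disjoint v∈A v∈B
    complete′ : ∀ {v} → Pushed p v → v ∈ range (suc p) c ++ A ⊎ v ∈ B
    complete′ {v} (p<v , v≤n) with v ≤? c + p
    ... | yes v≤c+p = inj₁ (∈-++⁺ˡ (∈-range⁺ (suc p) c p<v (s≤s (subst (v ≤_) (+-comm c p) v≤c+p))))
    ... | no  v≰c+p with complete (≰⇒> v≰c+p , v≤n)
    ...   | inj₁ v∈A = inj₁ (∈-++⁺ʳ (range (suc p) c) v∈A)
    ...   | inj₂ v∈B = inj₂ v∈B
    straddling′ : ∀ {v} → v ∈ range (suc p) c ++ A → suc v ∈ B → v ∈ boundaries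
    straddling′ v∈ sv∈B with ∈-++⁻ (range (suc p) c) v∈
    ... | inj₂ v∈A   = straddling v∈A sv∈B
    ... | inj₁ v∈new with ≤-antisym (proj₂ (new v∈new)) (≤-pred (proj₁ (B-pushed sv∈B)))
    ...   | refl = Equivalence.from boundary⇔moved sv∈B
    moved′ : ∀ {q} → q ∈ boundaries → p < q → suc q ∈ B
    moved′ q∈ p<q with m≤n⇒m<n∨m≡n (gap q∈ p<q)
    ... | inj₁ c+p<q = moved q∈ c+p<q
    ... | inj₂ refl  = Equivalence.to boundary⇔moved q∈
    across′ : ∀ {q v} → q ∈ boundaries → p < q → v ≤ q → v ∈ B → Precedes v (suc q) B
    across′ q∈ p<q v≤q v∈B with m≤n⇒m<n∨m≡n (gap q∈ p<q)
    ... | inj₁ c+p<q = across q∈ c+p<q v≤q v∈B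
    ... | inj₂ refl  = ⊥-elim (<⇒≱ (proj₁ (B-pushed v∈B)) v≤q)

  moveWhile-invariant : ∀ {p} A B → Invariant p A B → Ready A B →
                        uncurry (Invariant p) (moveWhile M A B) × uncurry Ready (moveWhile M A B)
  moveWhile-invariant []      B I ready = I , ready
  moveWhile-invariant (a ∷ A) B I ready with elemᵇ a M | elemᵇ-reflects-∈ a M
  ... | true  | _        = I , ready
  ... | false | ofⁿ a∉M = moveWhile-invariant A (a ∷ B) (pop I ready) (ready′ A (Invariant.A-increasing I))
    where
    ready′ : ∀ A → Linked _<_ (a ∷ A) → Ready A (a ∷ B)
    ready′ []      _          = nothing-just
    ready′ (_ ∷ _) (a<a′ ∷ _) = just (inj₂ (a<a′ , a∉M))

  moveWhile-count : ∀ A B → count∈ (proj₂ (moveWhile M A B)) M ≡ count∈ B M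
  moveWhile-count []      B = refl
  moveWhile-count (a ∷ A) B with elemᵇ a M | elemᵇ-reflects-∈ a M
  ... | true  | _        = refl
  ... | false | ofⁿ a∉M = trans (moveWhile-count A (a ∷ B)) (count∈-∷-∉ M a∉M)

  moveWhile-keeps-marked : ∀ A B {y} → y ∈ A → y ∈ M → y ∈ proj₁ (moveWhile M A B)
  moveWhile-keeps-marked (a ∷ A) B y∈ y∈M with elemᵇ a M | elemᵇ-reflects-∈ a M | y∈
  ... | true  | _        | _         = y∈
  ... | false | ofⁿ a∉M | here refl = ⊥-elim (a∉M y∈M)
  ... | false | _        | there y∈A = moveWhile-keeps-marked A (a ∷ B) y∈A y∈M

  moveWhile-top-marked : ∀ A B → Maybe.All (_∈ M) (head (proj₁ (moveWhile M A B)))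
  moveWhile-top-marked []      B = nothing
  moveWhile-top-marked (a ∷ A) B with elemᵇ a M | elemᵇ-reflects-∈ a M
  ... | true  | ofʸ a∈M = just a∈M
  ... | false | _        = moveWhile-top-marked A (a ∷ B)

  moveWhile-drains : ∀ a A B → All (_∉ M) (a ∷ A) →
    proj₁ (moveWhile M (a ∷ A) B) ≡ [] × Maybe.All (_∉ M) (head (proj₂ (moveWhile M (a ∷ A) B)))
  moveWhile-drains a A B (a∉M ∷ A∉M) with elemᵇ a M | elemᵇ-reflects-∈ a M
  ... | true  | ofʸ a∈M = ⊥-elim (a∉M a∈M)
  ... | false | _        with A | A∉M
  ...   | []      | _    = refl , just a∉M
  ...   | a′ ∷ A′ | A∉M′ = moveWhile-drains a′ A′ (a ∷ B) A∉M′

  moveWhile-⊇ : ∀ A B {y} → y ∈ B → y ∈ proj₂ (moveWhile M A B)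
  moveWhile-⊇ []      B y∈B = y∈B
  moveWhile-⊇ (a ∷ A) B y∈B with elemᵇ a M
  ... | true  = y∈B
  ... | false = moveWhile-⊇ A (a ∷ B) (there y∈B)

  drain : List ℕ → List ℕ → List ℕ × List ℕ
  drain A B = uncurry moveOne (moveWhile M A B)

  drain-moves-top : ∀ a A B → a ∈ proj₂ (drain (a ∷ A) B)
  drain-moves-top a A B with elemᵇ a M
  ... | true  = here refl
  ... | false = moveOne-⊇ (proj₁ (moveWhile M A (a ∷ B))) (moveWhile-⊇ A (a ∷ B) (here refl))
    where
    moveOne-⊇ : ∀ A {B y} → y ∈ B → y ∈ proj₂ (moveOne A B)
    moveOne-⊇ []      y∈B = y∈B
    moveOne-⊇ (_ ∷ _) y∈B = there y∈B

  -- At the start of round i: L = c_i ∷ … ∷ c_k, finished = s_2 … s_i, used = m_2 … m_i.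
  record RoundStart (L A B : List ℕ) : Set where
    field
      invariant        : Invariant (sum L) A B
      counter≤n        : sum L ≤ n
      top-marked       : Maybe.All (_∈ M) (head B)
      boundary⇔moved   : sum L ∈ boundaries ⇔ suc (sum L) ∈ B
      finished         : List ℕ
      boundaries-split : boundaries ≡ finished ++ suffixSums (drop 1 L)
      finished-above   : All (sum L ≤_) finished
      used unused      : List ℕ
      M-split          : M ≡ used ++ unused
      used-count       : count∈ B M ≡ length used
      used-above       : All (sum L <_) used
      unused-bounds    : Pointwise _>_ unused (suffixSums (drop 1 L))
      positive         : All (0 <_) L

  after-push : ∀ {c cs A B} → RoundStart (c ∷ cs) A B →
               Invariant (sum cs) (range (suc (sum cs)) c ++ A) B × Ready (range (suc (sum cs)) c ++ A) B
  after-push {zero} R with RoundStart.positive R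
  ... | () ∷ _
  after-push {suc c} {cs} {A} {B} R =
    push invariant counter≤n boundary⇔moved gap , ready top-marked (Invariant.B-pushed invariant)
    where
    open RoundStart R
    gap : ∀ {q} → q ∈ boundaries → sum cs < q → suc c + sum cs ≤ q
    gap q∈ s<q with ∈-++⁻ finished (subst (_ ∈_) boundaries-split q∈)
    ... | inj₁ q∈finished = All.lookup finished-above q∈finished
    ... | inj₂ q∈later    = ⊥-elim (<⇒≱ s<q (∈-suffixSums⇒≤sum cs q∈later))
    ready : ∀ {B} → Maybe.All (_∈ M) (head B) → (∀ {x} → x ∈ B → Pushed (suc c + sum cs) x) →
            Ready (range (suc (sum cs)) (suc c) ++ A) B
    ready {[]}    _          _     = just-nothing
    ready {b ∷ _} (just b∈M) above =
      just (inj₁ (<-≤-trans (s≤s (s≤s (m≤n+m (sum cs) c))) (proj₁ (above (here refl))) , b∈M))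

  -- m_2, …, m_{i+1} all exceed the new counter, but B holds only i − 1 marks.
  mark-after-push : ∀ {c c′ cs A B} → RoundStart (c ∷ c′ ∷ cs) A B →
                    ∃ λ y → y ∈ M × y ∈ range (suc (sum (c′ ∷ cs))) c ++ A
  mark-after-push {c} {c′} {cs} {A} {B} R
    with RoundStart.unused R | RoundStart.unused-bounds R | RoundStart.M-split R
  ... | r ∷ unused′ | r>p ∷ _ | M≡ = pick (count∈<length⇒∉ candidates fewer-in-B)
    where
    open RoundStart R using (used; used-count; used-above)
    candidates : List ℕ
    candidates = used ++ r ∷ []
    M≡′ : M ≡ candidates ++ unused′
    M≡′ = trans M≡ (sym (++-assoc used (r ∷ []) unused′))
    fewer-in-B : count∈ B candidates < length candidates
    fewer-in-B = begin-strict
      count∈ B candidates                    ≤⟨ m≤m+n _ _ ⟩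
      count∈ B candidates + count∈ B unused′ ≡⟨ count∈-++ B candidates unused′ ⟨
      count∈ B (candidates ++ unused′)       ≡⟨ cong (count∈ B) M≡′ ⟨
      count∈ B M                             ≡⟨ used-count ⟩
      length used                            <⟨ n<1+n _ ⟩
      suc (length used)                      ≡⟨ trans (length-++ used) (+-comm (length used) 1) ⟨
      length candidates                      ∎
      where open ≤-Reasoning
    above : ∀ {y} → y ∈ candidates → sum (c′ ∷ cs) < y
    above y∈ with ∈-++⁻ used y∈
    ... | inj₁ y∈used      = ≤-<-trans (m≤n+m _ c) (All.lookup used-above y∈used)
    ... | inj₂ (here refl) = r>p
    pick : (∃ λ y → y ∈ candidates × y ∉ B) → ∃ λ y → y ∈ M × y ∈ range (suc (sum (c′ ∷ cs))) c ++ A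
    pick (y , y∈ , y∉B) =
      y , y∈M , fromInj₁ (⊥-elim ∘ y∉B) (Invariant.complete (proj₁ (after-push R)) (above y∈ , M≤n y∈M))
      where
      y∈M : y ∈ M
      y∈M = subst (y ∈_) (sym M≡′) (∈-++⁺ˡ y∈)

  next-round : ∀ {c c′ cs A B} A₂ B₂ → RoundStart (c ∷ c′ ∷ cs) A B →
    Invariant (sum (c′ ∷ cs)) A₂ B₂ → Ready A₂ B₂ → Maybe.All (_∈ M) (head A₂) →
    count∈ B₂ M ≡ count∈ B M → (∃ λ y → y ∈ A₂) → suc (sum (c′ ∷ cs)) ∈ proj₂ (moveOne A₂ B₂) →
    uncurry (RoundStart (c′ ∷ cs)) (moveOne A₂ B₂)
  next-round [] _ _ _ _ _ _ (_ , ()) _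
  next-round {c} {c′} {cs} (a ∷ A₃) B₂ R I₂ ready₂ (just a∈M) count₂ _ moved
    with RoundStart.unused R | RoundStart.unused-bounds R | RoundStart.M-split R
  ... | r ∷ unused′ | r>p ∷ bounds′ | M≡ = record
    { invariant        = pop I₂ ready₂
    ; counter≤n        = ≤-trans (m≤n+m p c) counter≤n
    ; top-marked       = just a∈M
    ; boundary⇔moved   = mk⇔ (λ _ → moved) (λ _ → p∈boundaries)
    ; finished         = finished ++ p ∷ []
    ; boundaries-split = trans boundaries-split (sym (++-assoc finished (p ∷ []) (suffixSums cs)))
    ; finished-above   = All-++⁺ (All.map (≤-trans (m≤n+m p c)) finished-above) (≤-refl ∷ [])
    ; used             = used ++ r ∷ []
    ; unused           = unused′
    ; M-split          = trans M≡ (sym (++-assoc used (r ∷ []) unused′))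
    ; used-count       = begin
        count∈ (a ∷ B₂) M       ≡⟨ count∈-∷-∈ M M-unique a∈M (Invariant.disjoint I₂ (here refl)) ⟩
        suc (count∈ B₂ M)       ≡⟨ cong suc (trans count₂ used-count) ⟩
        suc (length used)       ≡⟨ trans (length-++ used) (+-comm (length used) 1) ⟨
        length (used ++ r ∷ []) ∎
    ; used-above       = All-++⁺ (All.map (≤-<-trans (m≤n+m p c)) used-above) (r>p ∷ [])
    ; unused-bounds    = bounds′
    ; positive         = All.tail positive
    }
    where
    open RoundStart R hiding (unused; unused-bounds; M-split)
    open ≡-Reasoning
    p : ℕ
    p = sum (c′ ∷ cs)
    p∈boundaries : p ∈ boundaries
    p∈boundaries = subst (p ∈_) (sym boundaries-split) (∈-++⁺ʳ finished (here refl))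

  round-step : ∀ {c c′ cs A B} → RoundStart (c ∷ c′ ∷ cs) A B →
               uncurry (RoundStart (c′ ∷ cs)) (drain (range (suc (sum (c′ ∷ cs))) c ++ A) B)
  round-step {zero} R with RoundStart.positive R
  ... | () ∷ _
  round-step {suc c} {c′} {cs} {A} {B} R with mark-after-push R
  ... | y , y∈M , y∈A′ =
    next-round _ _ R (proj₁ step2) (proj₂ step2) (moveWhile-top-marked A′ B) (moveWhile-count A′ B)
      (y , moveWhile-keeps-marked A′ B y∈A′ y∈M) (drain-moves-top (suc p) (range (suc (suc p)) c ++ A) B)
    where
    p : ℕ
    p = sum (c′ ∷ cs)
    A′ : List ℕ
    A′ = range (suc p) (suc c) ++ A
    step2 : uncurry (Invariant p) (moveWhile M A′ B) × uncurry Ready (moveWhile M A′ B)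
    step2 = moveWhile-invariant A′ B (proj₁ (after-push R)) (proj₂ (after-push R))

  Output : List ℕ → Set
  Output π = Invariant 0 [] π × Maybe.All (_∉ M) (head π)

  drained-output : ∀ A₂ B₂ → Invariant 0 A₂ B₂ → A₂ ≡ [] → Maybe.All (_∉ M) (head B₂) →
                   Output (proj₂ (moveOne A₂ B₂))
  drained-output .[] B₂ I refl top = I , top

  last-round : ∀ {c A B} → RoundStart (c ∷ []) A B → Output (proj₂ (drain (range 1 c ++ A) B))
  last-round {zero} R with RoundStart.positive R
  ... | () ∷ _
  last-round {suc c} {A} {B} R with RoundStart.unused R | RoundStart.unused-bounds R | RoundStart.M-split R
  ... | [] | [] | M≡ =
    drained-output _ _ (proj₁ (moveWhile-invariant A′ B I′ (proj₂ (after-push R))))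
                       (proj₁ drained) (proj₂ drained)
    where
    open RoundStart R using (used; used-count)
    A′ : List ℕ
    A′ = range 1 (suc c) ++ A
    I′ : Invariant 0 A′ B
    I′ = proj₁ (after-push R)
    all-used : count∈ B M ≡ length M
    all-used = trans used-count (cong length (trans (sym (++-identityʳ used)) (sym M≡)))
    unmarked : All (_∉ M) A′
    unmarked = All.tabulate λ y∈A′ y∈M → Invariant.disjoint I′ y∈A′ (count∈≡length⇒∈ M all-used y∈M)
    drained : proj₁ (moveWhile M A′ B) ≡ [] × Maybe.All (_∉ M) (head (proj₂ (moveWhile M A′ B)))
    drained = moveWhile-drains 1 (range 2 c ++ A) B unmarked

  runSteps-∷ : ∀ c cs A B → runSteps M (c ∷ cs) A B (c + sum cs) ≡
               uncurry (λ A′ B′ → runSteps M cs A′ B′ (sum cs)) (drain (range (suc (sum cs)) c ++ A) B)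
  runSteps-∷ c cs A B =
    cong (λ s → uncurry (λ A′ B′ → runSteps M cs A′ B′ (proj₂ s)) (drain (proj₁ s) B))
         (pushN-range c A (sum cs))

  run : ∀ {c cs A B} → RoundStart (c ∷ cs) A B → Output (runSteps M (c ∷ cs) A B (sum (c ∷ cs)))
  run {c} {[]}      {A} {B} R = subst Output (sym (runSteps-∷ c [] A B)) (last-round R)
  run {c} {c′ ∷ cs} {A} {B} R = subst Output (sym (runSteps-∷ c (c′ ∷ cs) A B)) (run (round-step R))

  initial : ∀ {c cs} → sum (c ∷ cs) ≡ n → All (0 <_) (c ∷ cs) → boundaries ≡ suffixSums cs →
            Pointwise _>_ M (suffixSums cs) → RoundStart (c ∷ cs) [] []
  initial {c} {cs} refl c∷cs>0 refl bounds = record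
    { invariant        = record
      { A-increasing = []
      ; A-pushed     = λ ()
      ; B-pushed     = λ ()
      ; disjoint     = λ ()
      ; complete     = λ (n<v , v≤n) → ⊥-elim (<⇒≱ n<v v≤n)
      ; B-steps      = []
      ; within       = λ ()
      ; straddling   = λ ()
      ; moved        = λ q∈ n<q → ⊥-elim (<⇒≱ n<q (≤-trans (∈-suffixSums⇒≤sum cs q∈) (m≤n+m _ c)))
      ; across       = λ _ _ _ ()
      }
    ; counter≤n        = ≤-refl
    ; top-marked       = nothing
    ; boundary⇔moved   = mk⇔ (λ n∈ → ⊥-elim (<⇒≱ sum<n (∈-suffixSums⇒≤sum cs n∈))) λ ()
    ; finished         = []
    ; boundaries-split = refl
    ; finished-above   = []
    ; used             = []
    ; unused           = M
    ; M-split          = refl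
    ; used-count       = cong length (filter-none (_∈? []) {M} (All.tabulate λ _ ()))
    ; used-above       = []
    ; unused-bounds    = bounds
    ; positive         = c∷cs>0
    }
    where
    sum<n : sum cs < c + sum cs
    sum<n = m<n+m (sum cs) (All.head c∷cs>0)

  output-complete : ∀ {π v} → Output π → 0 < v → v ≤ n → v ∈ π
  output-complete (I , _) 0<v v≤n = fromInj₂ (λ ()) (Invariant.complete I (0<v , v≤n))

  output-decreasing : ∀ {c cs π} → sum (c ∷ cs) ≡ n → boundaries ≡ suffixSums cs → Output π →
                      Blocks.DecreasingWithin (λ v → posOf v π) (c ∷ cs)
  output-decreasing refl refl out 0<v sv≤n v∉ =
    Precedes⇒posOf< (Invariant.within (proj₁ out) (output-complete out z<s sv≤n)
                                      (output-complete out 0<v (<⇒≤ sv≤n)) v∉)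

  output-increasing : ∀ {c cs π} → sum (c ∷ cs) ≡ n → boundaries ≡ suffixSums cs → Output π →
                      Blocks.IncreasingAcross (λ v → posOf v π) (c ∷ cs)
  output-increasing {c} {cs} refl refl out {q} q∈ 0<v v≤q =
    Precedes⇒posOf< (Invariant.across (proj₁ out) q∈ (<-≤-trans 0<v v≤q) v≤q
                                      (output-complete out 0<v (≤-trans v≤q q≤n)))
    where
    q≤n : q ≤ c + sum cs
    q≤n = ≤-trans (∈-suffixSums⇒≤sum cs q∈) (m≤n+m _ c)

lemma3p13 : (n : ℕ) (c m : List ℕ) → Consistent n c m →
    (∀ x → (x ∈ atops (stackProc n c m)) ⇔ (x ∈ drop 1 m)) ×
    ∃ (λ (Is : List (List ℕ)) →
      (Is ↭ inverseDescentRuns n (stackProc n c m)) ×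
      Linked _>_ (map maxL Is) ×
      map length Is ≡ c)
lemma3p13 n [] m ()
lemma3p13 n (c₁ ∷ cs) [] ()
lemma3p13 n (c₁ ∷ cs) (m₁ ∷ ms) (c₁≥2 , cs>0 , m>0 , refl , refl , m↓ , ms-bounds) =
  (λ x → mk⇔ (atops⊆marked π (Invariant.B-steps (proj₁ out)))
             (λ x∈ms → marked⊆atops π (Invariant.B-steps (proj₁ out)) (proj₂ out) x∈ms
                         (output-complete out (All.lookup m>0 (there x∈ms)) (<⇒≤ (ms<n x∈ms))))) ,
  blocks c ,
  subst (blocks c ↭_) (sym runs) (↭-sym (↭-reverse (blocks c))) ,
  maxima-blocks c c>0 decreasing increasing ,
  length-blocks c
  where
  c : List ℕ
  c = c₁ ∷ cs
  c>0 : All (0 <_) c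
  c>0 = ≤-trans (s≤s z≤n) c₁≥2 ∷ cs>0
  ms<n : ∀ {y} → y ∈ ms → y < n
  ms<n = linked⇒head >-trans m↓
  open Simulation ms n (suffixSums cs) (decreasing⇒unique (Linked.tail m↓)) (<⇒≤ ∘ ms<n)
  π : List ℕ
  π = stackProc n c (m₁ ∷ ms)
  out : Output π
  out = run (initial refl c>0 refl ms-bounds)
  open Blocks (λ v → posOf v π)
  decreasing : DecreasingWithin c
  decreasing = output-decreasing refl refl out
  increasing : IncreasingAcross c
  increasing = output-increasing refl refl out
  runs : inverseDescentRuns n π ≡ reverse (blocks c)
  runs = trans (cong descentRuns (inverse≡map-posOf n π)) (descentRuns-blocks c c>0 decreasing increasing)
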